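{- Let $V=[n]$, $k\ge1$, $\varepsilon\in(0,1)$, $B$ a positive integer with $B\le n$, and let $F:(k+1)^V\to\mathbb{R}_{\ge0}$ be $\varepsilon$-approximately $k$-submodular. Let $\mathbf{x}$ be the output of the $k$-Greedy-TS algorithm applied to $F$ and $B$. Then $F(\mathbf{x})\ge\frac{(1-\varepsilon)^2}{2(1-\varepsilon+\varepsilon B)(1+\varepsilon)}\max_{\mathbf{y}\in(k+1)^V,\ |\mathrm{supp}(\mathbf{y})|\le B}F(\mathbf{y})$.
   Context: $(k+1)^V$ is the set of $k$-tuples $\mathbf{x}=(X_1,\dots,X_k)$ of pairwise disjoint subsets of $V$, identified with vectors $\mathbf{x}\in\{0,1,\dots,k\}^V$ via $\mathbf{x}(e)=i\iff e\in X_i$; $\mathbf{0}$ is the all-empty tuple; $\mathrm{supp}(\mathbf{x})=\{e:\mathbf{x}(e)\ne0\}$; $\mathbf{x}\preceq\mathbf{y}$ means $X_i\subseteq Y_i$ for all $i$. $\Delta_{u,i}g(\mathbf{x})=g(X_1,\dots,X_i\cup\{u\},\dots,X_k)-g(\mathbf{x})$ for $u\notin\mathrm{supp}(\mathbf{x})$. A function $f$ is $k$-submodular if $\Delta_{u,i}f(\mathbf{x})\ge\Delta_{u,i}f(\mathbf{y})$ whenever $\mathbf{x}\preceq\mathbf{y}$, $u\notin\mathrm{supp}(\mathbf{y})$, and $\Delta_{u,i}f(\mathbf{x})+\Delta_{u,j}f(\mathbf{x})\ge0$ for $i\ne j$; monotone if $\mathbf{x}\preceq\mathbf{y}\Rightarrow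 f(\mathbf{x})\le f(\mathbf{y})$. $F$ is $\varepsilon$-approximately $k$-submodular if there is a monotone $k$-submodular $f$ with $(1-\varepsilon)f(\mathbf{x})\le F(\mathbf{x})\le(1+\varepsilon)f(\mathbf{x})$ for all $\mathbf{x}$; normalization $F(\mathbf{0})=f(\mathbf{0})=0$. $k$-Greedy-TS: start with $\mathbf{x}^{(0)}=\mathbf{0}$; for $j=1,\dots,B$ pick $(e^{(j)},i^{(j)})\in\arg\max_{e\in V\setminus\mathrm{supp}(\mathbf{x}^{(j-1)}),\,i\in[k]}\Delta_{e,i}F(\mathbf{x}^{(j-1)})$ (ties arbitrary) and let $\mathbf{x}^{(j)}$ be $\mathbf{x}^{(j-1)}$ with $\mathbf{x}^{(j)}(e^{(j)})=i^{(j)}$; output $\mathbf{x}=\mathbf{x}^{(B)}$.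
   Formalization: The parameter ε is rational, and F and the approximating monotone k-submodular f take values in the rationals instead of the reals. -}

module Defs where

open import Data.Nat using (ℕ; zero; suc)
open import Data.Fin using (Fin; zero; suc; _≟_)
open import Data.List using (List; length; filter; allFin)
open import Data.Integer using (+_)
open import Data.Rational using (ℚ; _+_; _-_; _*_; _≤_; 0ℚ; 1ℚ; _/_)
open import Relation.Nullary using (¬_; does; ¬?)
open import Data.Product using (Σ; _×_)
open import Relation.Binary.PropositionalEquality using (_≡_; _≢_)
open import Data.Bool using (if_then_else_)

-- An element of (k+1)^V with V = [n] = Fin n:  x e = zero  means e ∉ supp x,
-- x e = suc i  means e ∈ X_{i+1}  (i : Fin k ranges over the k labels).
Tup : ℕ → ℕ → Set
Tup n k = Fin n → Fin (suc k)

𝟎 : ∀ {n k} → Tup n k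
𝟎 _ = zero

update : ∀ {n k} → Tup n k → Fin n → Fin (suc k) → Tup n k
update x u v e = if does (e ≟ u) then v else x e

suppSize : ∀ {n k} → Tup n k → ℕ
suppSize {n} x = length (filter (λ e → ¬? (x e ≟ zero)) (allFin n))

_⪯_ : ∀ {n k} → Tup n k → Tup n k → Set
x ⪯ y = ∀ e → x e ≢ zero → y e ≡ x e

Δ : ∀ {n k} → (Tup n k → ℚ) → Fin n → Fin k → Tup n k → ℚ
Δ g u i x = g (update x u (suc i)) - g x

IsMonotone : ∀ {n k} → (Tup n k → ℚ) → Set
IsMonotone f = ∀ x y → x ⪯ y → f x ≤ f y

IsKSubmodular : ∀ {n k} → (Tup n k → ℚ) → Set
IsKSubmodular {n} {k} f =
  (∀ x y → x ⪯ y → ∀ u → y u ≡ zero → ∀ i → Δ f u i y ≤ Δ f u i x)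
  × (∀ x u → x u ≡ zero → ∀ i j → i ≢ j → 0ℚ ≤ Δ f u i x + Δ f u j x)

ApproxKSubmodular : ∀ {n k} → ℚ → (Tup n k → ℚ) → Set
ApproxKSubmodular {n} {k} ε F =
  Σ (Tup n k → ℚ) λ f →
    IsMonotone f × IsKSubmodular f × f 𝟎 ≡ 0ℚ ×
    (∀ x → ((1ℚ - ε) * f x ≤ F x) × (F x ≤ (1ℚ + ε) * f x))

-- GreedyRun F j x : x is a possible state x^(j) of k-Greedy-TS on F after j steps
-- (for some resolution of ties).
data GreedyRun {n k} (F : Tup n k → ℚ) : ℕ → Tup n k → Set where
  start : GreedyRun F 0 𝟎
  step  : ∀ {j x} → GreedyRun F j x →
          (e : Fin n) → x e ≡ zero → (i : Fin k) →
          (∀ e' → x e' ≡ zero → ∀ i' → Δ F e' i' x ≤ Δ F e i x) →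
          GreedyRun F (suc j) (update x e (suc i))

ℕ→ℚ : ℕ → ℚ
ℕ→ℚ m = (+ m) / 1

{-# OPTIONS --safe #-}
module Submission where

-- Fix y with |supp y| ≤ B and the monotone k-submodular f approximated by F, and write
-- a = 1 - ε.  Along the greedy run 𝟎 = x⁰ ⪯ x¹ ⪯ … ⪯ xᴮ we carry solutions oʲ ⪰ xʲ with o⁰ = y:
-- oʲ is oʲ⁻¹ with one element u ∈ supp oʲ⁻¹ ∖ supp xʲ⁻¹ (the greedy element e itself if
-- e ∈ supp oʲ⁻¹) removed and the greedy choice (e, i) inserted, or oʲ = xʲ once no such u exists.
-- Diminishing returns at u, greediness of (e, i) for F and the approximation bounds give
--   a f(oʲ⁻¹) + a f(xʲ⁻¹) ≤ a f(oʲ) + (1 + ε) f(xʲ),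
-- so the potential a f(oʲ) + (a + 2εj) f(xʲ) never drops below a f(y).  Each step removes an
-- element of supp o ∖ supp x while there is one, so after B ≥ |supp y| steps oᴮ ⪯ xᴮ and
-- a f(y) ≤ 2(a + εB) f(xᴮ); the bounds a f ≤ F ≤ (1 + ε) f transfer this to F.

open import Defs
open import Level using (0ℓ)
open import Function.Base using (_∘_)
open import Data.Empty using (⊥-elim)
open import Data.Product using (∃-syntax; _×_; _,_; proj₁; proj₂)
open import Data.Sum using (_⊎_; inj₁; inj₂)
open import Data.Nat using (ℕ; zero; suc; pred; _∸_; z≤n; _≤_; _<_)
import Data.Nat.Properties as ℕ
open import Data.Nat.Coprimality using (Coprime; 1-coprimeTo; sym)
open import Data.Fin using (Fin; zero; suc; _≟_)
open import Data.Fin.Properties using (any?; 0≢1+n)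
open import Data.Integer as ℤ using (ℤ; +_)
open import Data.Integer.Tactic.RingSolver using (solve-∀)
open import Data.List using (length; filter; allFin)
open import Data.List.Properties using (filter-some; filter-none)
open import Data.List.Membership.Propositional using (_∈_; lose)
open import Data.List.Membership.Propositional.Properties using (∈-filter⁺; ∈-filter⁻; ∈-allFin)
open import Data.List.Relation.Unary.All using (universal)
open import Data.List.Relation.Binary.Pointwise using (Pointwise-≡⇒≡)
open import Data.List.Relation.Binary.Sublist.Heterogeneous using (Sublist)
open import Data.List.Relation.Binary.Sublist.Heterogeneous.Properties
  using (length-mono-≤; toPointwise; ⊆-filter-Sublist)
open import Data.List.Relation.Binary.Sublist.Propositional using (⊆-refl)
open import Data.Rational using (ℚ; _+_; _-_; -_; _*_; 0ℚ; 1ℚ; mkℚ; toℚᵘ; nonNegative)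
  renaming (_≤_ to _≤ℚ_; _<_ to _<ℚ_)
open import Data.Rational.Properties
  using (normalize-coprime; toℚᵘ-injective; toℚᵘ-homo-+; nonNegative⁻¹; normalize-nonNeg;
         ≤-reflexive; ≤-trans; <⇒≤; +-mono-≤; +-monoˡ-≤; +-monoʳ-≤; neg-antimono-≤;
         *-monoˡ-≤-nonNeg; *-monoʳ-≤-nonNeg; nonNeg*nonNeg⇒nonNeg; *-zeroʳ; +-identityʳ; +-inverseʳ; +-comm;
         *-distribˡ-+; module ≤-Reasoning)
open import Data.Rational.Solver using (module +-*-Solver)
open import Data.Rational.Unnormalised as ℚᵘ using (*≡*)
import Data.Rational.Unnormalised.Properties as ℚᵘ
open import Relation.Nullary using (¬_; yes; no; ¬?)
open import Relation.Nullary.Decidable using (_×-dec_; dec-true; dec-false)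
open import Relation.Unary using (Pred; Decidable; _⊆_)
open import Relation.Binary.PropositionalEquality
  using (_≡_; _≢_; refl; cong; subst; trans) renaming (sym to ≡-sym)

module _ {A : Set} {P Q : Pred A 0ℓ} (P? : Decidable P) (Q? : Decidable Q) (Q⊆P : Q ⊆ P) where

  filter-⊆-filter : ∀ xs → Sublist _≡_ (filter Q? xs) (filter P? xs)
  filter-⊆-filter xs = ⊆-filter-Sublist Q? P? (λ { refl → Q⊆P }) (⊆-refl {x = xs})

  length-filter-mono-≤ : ∀ xs → length (filter Q? xs) ≤ length (filter P? xs)
  length-filter-mono-≤ xs = length-mono-≤ (filter-⊆-filter xs)

  length-filter-mono-< : ∀ {a xs} → a ∈ xs → P a → ¬ Q a →
                         length (filter Q? xs) < length (filter P? xs)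
  length-filter-mono-< {a} {xs} a∈xs Pa ¬Qa = ℕ.≤∧≢⇒< (length-filter-mono-≤ xs) (¬Qa ∘ Qa)
    where
    -- a sublist of the same length is the whole list
    Qa : length (filter Q? xs) ≡ length (filter P? xs) → Q a
    Qa eq = proj₂ (∈-filter⁻ Q? {xs = xs} (subst (a ∈_) filters-equal (∈-filter⁺ P? a∈xs Pa)))
      where
      filters-equal : filter P? xs ≡ filter Q? xs
      filters-equal = ≡-sym (Pointwise-≡⇒≡ (toPointwise eq (filter-⊆-filter xs)))

≢zero⇒≡suc : ∀ {m} {v : Fin (suc m)} → v ≢ zero → ∃[ l ] v ≡ suc l
≢zero⇒≡suc {v = zero}  v≢0 = ⊥-elim (v≢0 refl)
≢zero⇒≡suc {v = suc l} _   = l , refl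

module _ {n k : ℕ} where

  update-≡ : ∀ (x : Tup n k) u v → update x u v u ≡ v
  update-≡ x u v rewrite dec-true (u ≟ u) refl = refl

  update-≢ : ∀ (x : Tup n k) u v {e} → e ≢ u → update x u v e ≡ x e
  update-≢ x u v {e} e≢u rewrite dec-false (e ≟ u) e≢u = refl

  𝟎-⪯ : ∀ {x : Tup n k} → 𝟎 ⪯ x
  𝟎-⪯ _ 0≢0 = ⊥-elim (0≢0 refl)

  ⪯-update : ∀ {x : Tup n k} {u v} → x u ≡ zero → x ⪯ update x u v
  ⪯-update {x} {u} {v} xu≡0 d xd≢0 = update-≢ x u v λ { refl → xd≢0 xu≡0 }

  update-mono : ∀ {x y : Tup n k} {u v} → x ⪯ y → update x u v ⪯ update y u v
  update-mono {u = u} x⪯y d with d ≟ u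
  ... | yes _ = λ _ → refl
  ... | no _  = x⪯y d

  ⪯-update-zero : ∀ {x y : Tup n k} {u} → x ⪯ y → x u ≡ zero → x ⪯ update y u zero
  ⪯-update-zero {x} {y} {u} x⪯y xu≡0 d xd≢0 =
    trans (update-≢ y u zero λ { refl → xd≢0 xu≡0 }) (x⪯y d xd≢0)

  ⪯-reinsert : ∀ {y : Tup n k} {u v w} → y u ≡ v → y ⪯ update (update y u w) u v
  ⪯-reinsert {u = u} yu≡v d _ with d ≟ u
  ... | yes refl = ≡-sym yu≡v
  ... | no _     = refl

  supp⊆⇒⪯ : ∀ {x o : Tup n k} → x ⪯ o → (∀ d → o d ≢ zero → x d ≢ zero) → o ⪯ x
  supp⊆⇒⪯ x⪯o supp⊆ d od≢0 = ≡-sym (x⪯o d (supp⊆ d od≢0))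

  Missing : Tup n k → Tup n k → Pred (Fin n) 0ℓ
  Missing o x e = o e ≢ zero × x e ≡ zero

  missing? : ∀ o x → Decidable (Missing o x)
  missing? o x e = ¬? (o e ≟ zero) ×-dec (x e ≟ zero)

  suppDiffSize : Tup n k → Tup n k → ℕ
  suppDiffSize o x = length (filter (missing? o x) (allFin n))

  suppDiffSize-𝟎 : ∀ y → suppDiffSize y 𝟎 ≤ suppSize y
  suppDiffSize-𝟎 y = length-filter-mono-≤ (λ e → ¬? (y e ≟ zero)) (missing? y 𝟎) proj₁ (allFin n)

  suppDiffSize-self : ∀ x → suppDiffSize x x ≡ 0
  suppDiffSize-self x =
    cong length (filter-none (missing? x x) (universal (λ _ (x≢0 , x≡0) → x≢0 x≡0) (allFin n)))

  suppDiffSize≡0⇒⪯ : ∀ {x o} → x ⪯ o → suppDiffSize o x ≡ 0 → o ⪯ x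
  suppDiffSize≡0⇒⪯ {x} {o} x⪯o size≡0 = supp⊆⇒⪯ x⪯o λ d od≢0 xd≡0 →
    ℕ.<-irrefl (≡-sym size≡0) (filter-some (missing? o x) (lose (∈-allFin d) (od≢0 , xd≡0)))

  suppDiffSize-swap : ∀ (o x : Tup n k) u e v i → o u ≢ zero → x u ≡ zero →
    suppDiffSize (update (update o u zero) e v) (update x e (suc i)) < suppDiffSize o x
  suppDiffSize-swap o x u e v i ou≢0 xu≡0 =
    length-filter-mono-< (missing? o x) (missing? o⁺ x⁺) still-missing
      (∈-allFin u) (ou≢0 , xu≡0) u-filled
    where
    o⁺ = update (update o u zero) e v
    x⁺ = update x e (suc i)

    still-missing : Missing o⁺ x⁺ ⊆ Missing o x
    still-missing {d} _ with d ≟ e | d ≟ u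
    still-missing (_ , ()) | yes refl | _
    still-missing (o⁺d≢0 , _) | no _ | yes refl = ⊥-elim (o⁺d≢0 refl)
    still-missing missing | no _ | no _ = missing

    u-filled : ¬ Missing o⁺ x⁺ u
    u-filled _ with u ≟ e
    u-filled (_ , ()) | yes refl
    u-filled (o⁺u≢0 , _) | no _ = o⁺u≢0 (update-≡ o u zero)

  swap-candidate : ∀ {o x : Tup n k} {e} → x ⪯ o → x e ≡ zero →
    o ⪯ x ⊎ ∃[ u ] (Missing o x u × update o u zero e ≡ zero)
  swap-candidate {o} {x} {e} x⪯o xe≡0 with o e ≟ zero | any? (missing? o x)
  ... | no oe≢0 | _                  = inj₂ (e , (oe≢0 , xe≡0) , update-≡ o e zero)
  ... | yes _   | no nothing-missing =
    inj₁ (supp⊆⇒⪯ x⪯o λ d od≢0 xd≡0 → nothing-missing (d , od≢0 , xd≡0))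
  ... | yes oe≡0 | yes (u , u-missing) = inj₂ (u , u-missing , e-freed)
    where
    e-freed : update o u zero e ≡ zero
    e-freed with e ≟ u
    ... | yes refl = refl
    ... | no _     = oe≡0

coprimeTo1 : ∀ m → Coprime m 1
coprimeTo1 m = sym (1-coprimeTo m)

ℕ→ℚ≡mkℚ : ∀ m → ℕ→ℚ m ≡ mkℚ (+ m) 0 (coprimeTo1 m)
ℕ→ℚ≡mkℚ m = normalize-coprime (coprimeTo1 m)

ℕ→ℚ-suc : ∀ m → ℕ→ℚ (suc m) ≡ 1ℚ + ℕ→ℚ m
ℕ→ℚ-suc m rewrite ℕ→ℚ≡mkℚ m | ℕ→ℚ≡mkℚ (suc m) = toℚᵘ-injective
    (ℚᵘ.≃-trans (*≡* (cross-multiplied (+ m)))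
                (ℚᵘ.≃-sym (toℚᵘ-homo-+ 1ℚ (mkℚ (+ m) 0 (coprimeTo1 m)))))
  where
  cross-multiplied : ∀ (z : ℤ) →
    (+ 1 ℤ.+ z) ℤ.* (+ 1 ℤ.* + 1) ≡ (+ 1 ℤ.* + 1 ℤ.+ z ℤ.* + 1) ℤ.* + 1
  cross-multiplied = solve-∀

0≤ℕ→ℚ : ∀ m → 0ℚ ≤ℚ ℕ→ℚ m
0≤ℕ→ℚ m = nonNegative⁻¹ _ {{normalize-nonNeg m 1}}

p≤q⇒0≤q-p : ∀ {p q} → p ≤ℚ q → 0ℚ ≤ℚ q - p
p≤q⇒0≤q-p {p} {q} p≤q = begin
  0ℚ       ≡⟨ +-inverseʳ p ⟨
  p - p    ≤⟨ +-monoˡ-≤ (- p) p≤q ⟩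
  q - p    ∎
  where open ≤-Reasoning

p-r≤q-r⇒p≤q : ∀ p q r → p - r ≤ℚ q - r → p ≤ℚ q
p-r≤q-r⇒p≤q p q r h = begin
  p            ≡⟨ cancel p r ⟨
  (p - r) + r  ≤⟨ +-monoˡ-≤ r h ⟩
  (q - r) + r  ≡⟨ cancel q r ⟩
  q            ∎
  where
  open ≤-Reasoning
  open +-*-Solver
  cancel : ∀ p r → (p - r) + r ≡ p
  cancel = solve 2 (λ p r → (p :- r) :+ r := p) refl

p-q≤r-s⇒p+s≤r+q : ∀ p q r s → p - q ≤ℚ r - s → p + s ≤ℚ r + q
p-q≤r-s⇒p+s≤r+q p q r s h = begin
  p + s              ≡⟨ regroup p q s ⟨
  (p - q) + (q + s)  ≤⟨ +-monoˡ-≤ (q + s) h ⟩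
  (r - s) + (q + s)  ≡⟨ cong (_+_ (r - s)) (+-comm q s) ⟩
  (r - s) + (s + q)  ≡⟨ regroup r s q ⟩
  r + q              ∎
  where
  open ≤-Reasoning
  open +-*-Solver
  regroup : ∀ p q s → (p - q) + (q + s) ≡ p + s
  regroup = solve 3 (λ p q s → (p :- q) :+ (q :+ s) := p :+ s) refl

*-monoˡ-≤-0≤ : ∀ {r p q} → 0ℚ ≤ℚ r → p ≤ℚ q → r * p ≤ℚ r * q
*-monoˡ-≤-0≤ {r} 0≤r = *-monoˡ-≤-nonNeg r {{nonNegative 0≤r}}

0≤* : ∀ {p q} → 0ℚ ≤ℚ p → 0ℚ ≤ℚ q → 0ℚ ≤ℚ p * q
0≤* {p} {q} 0≤p 0≤q =
  nonNegative⁻¹ _ {{nonNeg*nonNeg⇒nonNeg p {{nonNegative 0≤p}} q {{nonNegative 0≤q}}}}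

module GreedyAnalysis {n k : ℕ} (ε : ℚ) (0≤ε : 0ℚ ≤ℚ ε) (ε≤1 : ε ≤ℚ 1ℚ) (F f : Tup n k → ℚ)
  (f-mono : IsMonotone f)
  (f-submod : ∀ x y → x ⪯ y → ∀ u → y u ≡ zero → ∀ i → Δ f u i y ≤ℚ Δ f u i x)
  (f-𝟎 : f 𝟎 ≡ 0ℚ)
  (F-lower : ∀ x → (1ℚ - ε) * f x ≤ℚ F x) (F-upper : ∀ x → F x ≤ℚ (1ℚ + ε) * f x)
  where

  open ≤-Reasoning

  a : ℚ
  a = 1ℚ - ε

  two : ℚ
  two = 1ℚ + 1ℚ

  0≤a : 0ℚ ≤ℚ a
  0≤a = p≤q⇒0≤q-p ε≤1

  0≤two : 0ℚ ≤ℚ two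
  0≤two = nonNegative⁻¹ two

  0≤1+ε : 0ℚ ≤ℚ 1ℚ + ε
  0≤1+ε = +-mono-≤ (nonNegative⁻¹ 1ℚ) 0≤ε

  a≤1+ε : a ≤ℚ 1ℚ + ε
  a≤1+ε = +-monoʳ-≤ 1ℚ (≤-trans (neg-antimono-≤ 0≤ε) 0≤ε)

  0≤f : ∀ x → 0ℚ ≤ℚ f x
  0≤f x = subst (_≤ℚ f x) f-𝟎 (f-mono 𝟎 x 𝟎-⪯)

  IsGreedyChoice : Tup n k → Fin n → Fin k → Set
  IsGreedyChoice x e i = ∀ u → x u ≡ zero → ∀ l → Δ F u l x ≤ℚ Δ F e i x

  record Exchange (o x : Tup n k) (e : Fin n) (i : Fin k) : Set where
    field
      o⁺            : Tup n k
      extends       : update x e (suc i) ⪯ o⁺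
      fewer-missing : suppDiffSize o⁺ (update x e (suc i)) ≤ pred (suppDiffSize o x)
      gain          : a * f o + a * f x ≤ℚ a * f o⁺ + (1ℚ + ε) * f (update x e (suc i))

  exchange-covered : ∀ {o x e i} → o ⪯ x → x e ≡ zero → Exchange o x e i
  exchange-covered {o} {x} {e} {i} o⪯x xe≡0 = record
    { o⁺            = x⁺
    ; extends       = λ _ _ → refl
    ; fewer-missing = ℕ.≤-trans (ℕ.≤-reflexive (suppDiffSize-self x⁺)) z≤n
    ; gain          = begin
        a * f o + a * f x           ≤⟨ +-mono-≤ (*-monoˡ-≤-0≤ 0≤a (≤-trans (f-mono o x o⪯x) fx≤fx⁺))
                                                (*-monoˡ-≤-0≤ 0≤a fx≤fx⁺) ⟩
        a * f x⁺ + a * f x⁺         ≤⟨ +-monoʳ-≤ (a * f x⁺) afx⁺≤[1+ε]fx⁺ ⟩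
        a * f x⁺ + (1ℚ + ε) * f x⁺  ∎
    }
    where
    x⁺ = update x e (suc i)
    fx≤fx⁺ : f x ≤ℚ f x⁺
    fx≤fx⁺ = f-mono x x⁺ (⪯-update xe≡0)
    afx⁺≤[1+ε]fx⁺ : a * f x⁺ ≤ℚ (1ℚ + ε) * f x⁺
    afx⁺≤[1+ε]fx⁺ = *-monoʳ-≤-nonNeg (f x⁺) {{nonNegative (0≤f x⁺)}} a≤1+ε

  exchange-swap : ∀ {o x e i u l} → x ⪯ o → IsGreedyChoice x e i →
    o u ≡ suc l → x u ≡ zero → update o u zero e ≡ zero → Exchange o x e i
  exchange-swap {o} {x} {e} {i} {u} {l} x⪯o greedy ou≡l xu≡0 he≡0 = record
    { o⁺            = o⁺
    ; extends       = update-mono x⪯h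
    ; fewer-missing = ℕ.<⇒≤pred (suppDiffSize-swap o x u e (suc i) i ou≢0 xu≡0)
    ; gain          = begin
        a * f o + a * f x            ≡⟨ *-distribˡ-+ a (f o) (f x) ⟨
        a * (f o + f x)              ≤⟨ *-monoˡ-≤-0≤ 0≤a (+-monoˡ-≤ (f x) fo≤foᵤ) ⟩
        a * (f oᵤ + f x)             ≤⟨ *-monoˡ-≤-0≤ 0≤a diminishing-returns ⟩
        a * (f xᵤ + f h)             ≤⟨ *-monoˡ-≤-0≤ 0≤a (+-monoʳ-≤ (f xᵤ) fh≤fo⁺) ⟩
        a * (f xᵤ + f o⁺)            ≡⟨ *-distribˡ-+ a (f xᵤ) (f o⁺) ⟩
        a * f xᵤ + a * f o⁺          ≤⟨ +-monoˡ-≤ (a * f o⁺) (F-lower xᵤ) ⟩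
        F xᵤ + a * f o⁺              ≤⟨ +-monoˡ-≤ (a * f o⁺) greedy-at-u ⟩
        F x⁺ + a * f o⁺              ≤⟨ +-monoˡ-≤ (a * f o⁺) (F-upper x⁺) ⟩
        (1ℚ + ε) * f x⁺ + a * f o⁺   ≡⟨ +-comm ((1ℚ + ε) * f x⁺) (a * f o⁺) ⟩
        a * f o⁺ + (1ℚ + ε) * f x⁺   ∎
    }
    where
    h  = update o u zero
    o⁺ = update h e (suc i)
    oᵤ = update h u (suc l)
    x⁺ = update x e (suc i)
    xᵤ = update x u (suc l)
    x⪯h : x ⪯ h
    x⪯h = ⪯-update-zero x⪯o xu≡0
    ou≢0 : o u ≢ zero
    ou≢0 ou≡0 = 0≢1+n (trans (≡-sym ou≡0) ou≡l)
    fo≤foᵤ : f o ≤ℚ f oᵤ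
    fo≤foᵤ = f-mono o oᵤ (⪯-reinsert ou≡l)
    fh≤fo⁺ : f h ≤ℚ f o⁺
    fh≤fo⁺ = f-mono h o⁺ (⪯-update he≡0)
    diminishing-returns : f oᵤ + f x ≤ℚ f xᵤ + f h
    diminishing-returns =
      p-q≤r-s⇒p+s≤r+q (f oᵤ) (f h) (f xᵤ) (f x) (f-submod x h x⪯h u (update-≡ o u zero) l)
    greedy-at-u : F xᵤ ≤ℚ F x⁺
    greedy-at-u = p-r≤q-r⇒p≤q (F xᵤ) (F x⁺) (F x) (greedy u xu≡0 l)

  exchange : ∀ {o x e i} → x ⪯ o → x e ≡ zero → IsGreedyChoice x e i → Exchange o x e i
  exchange x⪯o xe≡0 greedy with swap-candidate x⪯o xe≡0
  ... | inj₁ o⪯x                         = exchange-covered o⪯x xe≡0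
  ... | inj₂ (u , (ou≢0 , xu≡0) , he≡0) with ≢zero⇒≡suc ou≢0
  ...   | l , ou≡l = exchange-swap x⪯o greedy ou≡l xu≡0 he≡0

  weight : ℕ → ℚ
  weight j = a + two * ε * ℕ→ℚ j

  record Invariant (B : ℕ) (y : Tup n k) (j : ℕ) (x : Tup n k) : Set where
    field
      o       : Tup n k
      x⪯o     : x ⪯ o
      missing : suppDiffSize o x ≤ B ∸ j
      bound   : a * f y ≤ℚ a * f o + weight j * f x

  invariant-start : ∀ {B y} → suppSize y ≤ B → Invariant B y 0 𝟎
  invariant-start {y = y} y-small = record
    { o       = y
    ; x⪯o     = 𝟎-⪯
    ; missing = ℕ.≤-trans (suppDiffSize-𝟎 y) y-small
    ; bound   = ≤-reflexive (≡-sym no-weight)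
    }
    where
    no-weight : a * f y + weight 0 * f 𝟎 ≡ a * f y
    no-weight rewrite f-𝟎 | *-zeroʳ (weight 0) = +-identityʳ (a * f y)

  invariant-step : ∀ {B y j x e i} → x e ≡ zero → IsGreedyChoice x e i →
    Invariant B y j x → Invariant B y (suc j) (update x e (suc i))
  invariant-step {B} {y} {j} {x} {e} {i} xe≡0 greedy inv = record
    { o       = o⁺
    ; x⪯o     = extends
    ; missing = ℕ.≤-trans fewer-missing (subst (pred (suppDiffSize o x) ≤_)
                                                (ℕ.pred[m∸n]≡m∸[1+n] B j) (ℕ.pred-mono-≤ missing))
    ; bound   = begin
        a * f y                                     ≤⟨ bound ⟩
        a * f o + weight j * f x                    ≡⟨ split (f o) (f x) ⟩
        (a * f o + a * f x) + c * f x               ≤⟨ +-mono-≤ gain (*-monoˡ-≤-0≤ 0≤c fx≤fx⁺) ⟩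
        (a * f o⁺ + (1ℚ + ε) * f x⁺) + c * f x⁺     ≡⟨ merge (f o⁺) (f x⁺) ⟩
        a * f o⁺ + weight (suc j) * f x⁺            ∎
    }
    where
    open Invariant inv
    open Exchange (exchange x⪯o xe≡0 greedy)
    open +-*-Solver
    x⁺ = update x e (suc i)
    c  = two * ε * ℕ→ℚ j
    0≤c : 0ℚ ≤ℚ c
    0≤c = 0≤* (0≤* 0≤two 0≤ε) (0≤ℕ→ℚ j)
    fx≤fx⁺ : f x ≤ℚ f x⁺
    fx≤fx⁺ = f-mono x x⁺ (⪯-update xe≡0)
    split : ∀ p q → a * p + weight j * q ≡ (a * p + a * q) + c * q
    split p q =
      solve 4 (λ a c p q → a :* p :+ (a :+ c) :* q := (a :* p :+ a :* q) :+ c :* q) refl a c p q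
    merge : ∀ p q → (a * p + (1ℚ + ε) * q) + c * q ≡ a * p + weight (suc j) * q
    merge p q rewrite ℕ→ℚ-suc j = solve 4 (λ ε J p q →
        ((con 1ℚ :- ε) :* p :+ (con 1ℚ :+ ε) :* q) :+ (con two :* ε :* J) :* q
      := (con 1ℚ :- ε) :* p :+ ((con 1ℚ :- ε) :+ con two :* ε :* (con 1ℚ :+ J)) :* q)
      refl ε (ℕ→ℚ j) p q

  greedy-invariant : ∀ {B y j x} → suppSize y ≤ B → GreedyRun F j x → Invariant B y j x
  greedy-invariant y-small start                      = invariant-start y-small
  greedy-invariant y-small (step run _ xe≡0 _ greedy) =
    invariant-step xe≡0 greedy (greedy-invariant y-small run)

  invariant-end : ∀ {B y x} → Invariant B y B x → a * f y ≤ℚ (two * (a + ε * ℕ→ℚ B)) * f x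
  invariant-end {B} {y} {x} inv = begin
    a * f y                         ≤⟨ bound ⟩
    a * f o + weight B * f x        ≤⟨ +-monoˡ-≤ (weight B * f x) (*-monoˡ-≤-0≤ 0≤a fo≤fx) ⟩
    a * f x + weight B * f x        ≡⟨ collect (f x) ⟩
    (two * (a + ε * ℕ→ℚ B)) * f x   ∎
    where
    open Invariant inv
    open +-*-Solver
    nothing-missing : suppDiffSize o x ≡ 0
    nothing-missing = ℕ.n≤0⇒n≡0 (subst (suppDiffSize o x ≤_) (ℕ.n∸n≡0 B) missing)
    fo≤fx : f o ≤ℚ f x
    fo≤fx = f-mono o x (suppDiffSize≡0⇒⪯ x⪯o nothing-missing)
    collect : ∀ p → a * p + weight B * p ≡ (two * (a + ε * ℕ→ℚ B)) * p
    collect p = solve 4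
      (λ a ε B p → a :* p :+ (a :+ con two :* ε :* B) :* p := (con two :* (a :+ ε :* B)) :* p)
      refl a ε (ℕ→ℚ B) p

  f-bound⇒F-bound : ∀ {c y x} → 0ℚ ≤ℚ c → a * f y ≤ℚ c * f x →
    (a * a) * F y ≤ℚ (c * (1ℚ + ε)) * F x
  f-bound⇒F-bound {c} {y} {x} 0≤c fy≤cfx = begin
    (a * a) * F y                ≤⟨ *-monoˡ-≤-0≤ (0≤* 0≤a 0≤a) (F-upper y) ⟩
    (a * a) * ((1ℚ + ε) * f y)   ≡⟨ shuffle a a (1ℚ + ε) (f y) ⟩
    ((1ℚ + ε) * a) * (a * f y)   ≤⟨ *-monoˡ-≤-0≤ (0≤* 0≤1+ε 0≤a) fy≤cfx ⟩
    ((1ℚ + ε) * a) * (c * f x)   ≡⟨ shuffle a (1ℚ + ε) c (f x) ⟩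
    (c * (1ℚ + ε)) * (a * f x)   ≤⟨ *-monoˡ-≤-0≤ (0≤* 0≤c 0≤1+ε) (F-lower x) ⟩
    (c * (1ℚ + ε)) * F x         ∎
    where
    open +-*-Solver
    shuffle : ∀ a b c p → (b * a) * (c * p) ≡ (c * b) * (a * p)
    shuffle = solve 4 (λ a b c p → (b :* a) :* (c :* p) := (c :* b) :* (a :* p)) refl

  greedy-guarantee : ∀ {B y x} → suppSize y ≤ B → GreedyRun F B x →
    (a * a) * F y ≤ℚ ((two * (a + ε * ℕ→ℚ B)) * (1ℚ + ε)) * F x
  greedy-guarantee {B} y-small run =
    f-bound⇒F-bound 0≤c (invariant-end (greedy-invariant y-small run))
    where
    0≤c : 0ℚ ≤ℚ two * (a + ε * ℕ→ℚ B)
    0≤c = 0≤* 0≤two (+-mono-≤ 0≤a (0≤* 0≤ε (0≤ℕ→ℚ B)))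

theorem4 : (n k B : ℕ) → 1 ≤ k → 1 ≤ B → B ≤ n →
    (ε : ℚ) → 0ℚ <ℚ ε → ε <ℚ 1ℚ →
    (F : Tup n k → ℚ) → (∀ x → 0ℚ ≤ℚ F x) → F 𝟎 ≡ 0ℚ → ApproxKSubmodular ε F →
    (x : Tup n k) → GreedyRun F B x →
    (y : Tup n k) → suppSize y ≤ B →
    ((1ℚ - ε) * (1ℚ - ε)) * F y
      ≤ℚ ((1ℚ + 1ℚ) * (1ℚ - ε + ε * ℕ→ℚ B) * (1ℚ + ε)) * F x
theorem4 _ _ _ _ _ _ ε 0<ε ε<1 F _ _ (f , f-mono , (f-submod , _) , f-𝟎 , F≈f) _ run _ y-small =
  greedy-guarantee y-small run
  where
  open GreedyAnalysis ε (<⇒≤ 0<ε) (<⇒≤ ε<1) F f f-mono f-submod f-𝟎 (proj₁ ∘ F≈f) (proj₂ ∘ F≈f)
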